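{- There is a linear-size conservative reduction from $\mathrm{FO}_{=}$ formulas into $\mathrm{FO}3$ formulas without equality; that is, a computable map $f$ from $\mathrm{FO}_{=}$ formulas to $\mathrm{FO}3$ formulas without equality such that $\|f(\varphi)\|$ is bounded by a linear function of $\|\varphi\|$, $\varphi$ is satisfiable iff $f(\varphi)$ is satisfiable, and $\varphi$ is finitely satisfiable iff $f(\varphi)$ is finitely satisfiable.
   Context: Fix a countably infinite set $\Sigma$ of binary predicate symbols and a countably infinite set $\mathbf{V}$ of variables. A structure $\mathfrak{A}$ over a set of symbols consists of a non-empty set $|\mathfrak{A}|$ and a binary relation on it for each symbol; it is finite if $|\mathfrak{A}|$ is finite. $\mathrm{FO}_{=}$ formulas: $\varphi::= a(x,y)\mid x=y\mid \lnot\varphi\mid \varphi\land\psi\mid \exists x,\varphi$ ($a\in\Sigma$, $x,y\in\mathbf{V}$), with the usual semantics. A formula is satisfiable (resp. finitely satisfiable) if some assignment in some structure (resp. finite structure) satisfies it. Size: $\|a(x,y)\|=\|x=y\|=3$, $\|\lnot\varphi\|=1+\|\varphi\|$, $\|\varphi\land\psi\|=1+\|\varphi\|+\|\psi\|$, $\|\exists x,\varphi\|=2+\|\varphi\|$. $\mathrm{V}(\varphi)$ is the set of variables occurring (free or bound) in $\varphi$; $\mathrm{FO}3_{=}$ is the set of formulas with $\#\mathrm{V}(\varphi)\le 3$, and $\mathrm{FO}3$ formulas without equality are those among them with no atom of the form $x=y$. -}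

module Defs where

open import Data.Nat using (ℕ; _+_; _*_; _≤_; _≡ᵇ_)
open import Data.Nat.Properties using (_≟_)
open import Data.Bool using (Bool; true; false; if_then_else_)
open import Data.List using (List; []; _∷_; _++_; length; deduplicate)
open import Data.Fin using (Fin)
open import Data.Product using (Σ; ∃; _×_)
open import Data.Empty using (⊥)
open import Data.Unit using (⊤)
open import Function.Bundles using (_↔_)
open import Relation.Binary.PropositionalEquality using (_≡_)

Sym : Set
Sym = ℕ

Var : Set
Var = ℕ

data Fm : Set where
  atom : Sym → Var → Var → Fm
  eq   : Var → Var → Fm
  neg  : Fm → Fm
  conj : Fm → Fm → Fm
  ex   : Var → Fm → Fm

size : Fm → ℕ
size (atom a x y) = 3
size (eq x y)     = 3
size (neg φ)      = 1 + size φ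
size (conj φ ψ)   = 1 + size φ + size ψ
size (ex x φ)     = 2 + size φ

vars : Fm → List Var
vars (atom a x y) = x ∷ y ∷ []
vars (eq x y)     = x ∷ y ∷ []
vars (neg φ)      = vars φ
vars (conj φ ψ)   = vars φ ++ vars ψ
vars (ex x φ)     = x ∷ vars φ

numVars : Fm → ℕ
numVars φ = length (deduplicate _≟_ (vars φ))

EqFree : Fm → Set
EqFree (atom a x y) = ⊤
EqFree (eq x y)     = ⊥
EqFree (neg φ)      = EqFree φ
EqFree (conj φ ψ)   = EqFree φ × EqFree ψ
EqFree (ex x φ)     = EqFree φ

IsFO3NoEq : Fm → Set
IsFO3NoEq φ = (numVars φ ≤ 3) × EqFree φ

record Structure : Set₁ where
  field
    Carrier : Set
    rel     : Sym → Carrier → Carrier → Set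

open Structure public

update : {A : Set} → (Var → A) → Var → A → Var → A
update ρ x d y = if y ≡ᵇ x then d else ρ y

⟦_⟧ : Fm → (𝔄 : Structure) → (Var → Carrier 𝔄) → Set
⟦ atom a x y ⟧ 𝔄 ρ = rel 𝔄 a (ρ x) (ρ y)
⟦ eq x y ⟧     𝔄 ρ = ρ x ≡ ρ y
⟦ neg φ ⟧      𝔄 ρ = ⟦ φ ⟧ 𝔄 ρ → ⊥
⟦ conj φ ψ ⟧   𝔄 ρ = ⟦ φ ⟧ 𝔄 ρ × ⟦ ψ ⟧ 𝔄 ρ
⟦ ex x φ ⟧     𝔄 ρ = Σ (Carrier 𝔄) λ d → ⟦ φ ⟧ 𝔄 (update ρ x d)

-- A structure is finite if its carrier is in bijection with some Fin n
-- (non-emptiness is implied by the existence of an assignment).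
IsFinite : Structure → Set
IsFinite 𝔄 = ∃ λ n → Carrier 𝔄 ↔ Fin n

Satisfiable : Fm → Set₁
Satisfiable φ = Σ Structure λ 𝔄 → Σ (Var → Carrier 𝔄) λ ρ → ⟦ φ ⟧ 𝔄 ρ

FinSatisfiable : Fm → Set₁
FinSatisfiable φ =
  Σ Structure λ 𝔄 → IsFinite 𝔄 × Σ (Var → Carrier 𝔄) λ ρ → ⟦ φ ⟧ 𝔄 ρ

-- A model of the reduced formula is read as a space of "points", each coding a finite tuple of
-- elements: coord i p u says that the i-th coordinate of p is u, and agree d p q that p and q share
-- their first d coordinates.  Each variable of φ gets a coordinate, and the variable bound by the
-- d-th nested quantifier gets a fresh one, so ∃x ψ becomes "some point agreeing with the current one
-- below the new coordinate satisfies ψ", and an atom is checked on two coordinates of the current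
-- point.  Three variables then suffice: one for the current point and two for values or the next
-- point.  Equality is replaced by a fresh symbol axiomatised as a congruence, and the layer axioms
-- make coordinates functional, total and independently updatable.
--
-- A model of φ gives a model of the reduction whose points are vectors, finite if the model is.
-- Conversely, a model of the reduction interprets φ with equality read as the congruence; its
-- quotient is a genuine model.  Without choice the quotient is taken over an enumeration: the whole
-- model if it is finite, and otherwise a countable hull closed under witnesses, with excluded middle
-- used to pick witnesses and least representatives.

{-# OPTIONS --safe #-}
module Submission where

open import Defs
open import Axiom.ExcludedMiddle using (ExcludedMiddle)
open import Level using (0ℓ)
open import Data.Bool using (Bool; true; false; T; if_then_else_)
open import Data.Bool.Properties using (T-irrelevant)
open import Data.Empty using (⊥-elim)
open import Data.Unit using (⊤; tt)
open import Data.Nat using (ℕ; zero; suc; _+_; _*_; _^_; _≤_; _<_; _≡ᵇ_; z≤n; s≤s; s≤s⁻¹; _<?_)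
open import Data.Nat.Induction using (<-wellFounded)
open import Data.Nat.Properties
  using (_≟_; ≤∧≢⇒<; ≤-refl; ≤-trans; <-≤-trans; <-cmp; n≤1+n; <⇒≤; m≤n⇒m<n∨m≡n; ≤⇒≯;
         +-identityʳ; +-suc; m+n≤o⇒m≤o; m+n≤o⇒n≤o;
         +-assoc; *-suc; +-mono-≤; +-monoˡ-≤; +-monoʳ-≤; *-monoˡ-≤; m≤n⇒m≤1+n; m≤m+n; m≤n+m;
         ≤-reflexive; module ≤-Reasoning)
open import Data.Nat.Tactic.RingSolver using (solve-∀)
open import Data.List using (List; []; _∷_; _++_; length; map; downFrom; lookup)
open import Data.List.Relation.Unary.All as All using (All; []; _∷_; all?)
open import Data.List.Relation.Unary.All.Properties using (++⁺; map⁺; map⁻; deduplicate⁺)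
open import Data.List.Relation.Unary.Unique.Propositional using (Unique)
open import Data.List.Relation.Unary.AllPairs using (_∷_)
open import Data.List.Relation.Unary.Unique.DecPropositional.Properties _≟_ using (deduplicate-!)
open import Data.List.Membership.Propositional using (_∈_)
open import Data.List.Membership.Propositional.Properties
  using (∈-++⁺ˡ; ∈-++⁺ʳ; ∈-++⁻; ∈-map⁺; ∈-lookup; ∈-downFrom⁺; ∈-downFrom⁻)
open import Data.List.Properties using (length-map; length-++; length-downFrom)
open import Data.List.Relation.Binary.Subset.Propositional using (_⊆_)
open import Data.List.Relation.Unary.Any using (here; there)
open import Data.Product using (Σ; _×_; _,_; proj₁; proj₂; uncurry)
open import Data.Product.Function.Dependent.Propositional using (congˡ)
open import Data.Product.Function.NonDependent.Propositional using (_×-⇔_; _×-↔_)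
open import Data.Sum using (_⊎_; inj₁; inj₂)
open import Data.Vec using (Vec; []; _∷_; head; replicate; uncons)
open import Data.Sum.Function.Propositional using (_⊎-↔_)
open import Data.Fin using (Fin; toℕ; fromℕ<)
import Data.Fin as Fin
open import Data.Fin.Properties
  using (¬Fin0; 0↔⊥; 1↔⊤; +↔⊎; *↔×; fromℕ<-toℕ; toℕ-fromℕ<; toℕ<n; injective⇒≤)
open import Function.Base using (_∘_; id)
open import Function.Bundles using (_⇔_; mk⇔; Equivalence; _↔_; mk↔ₛ′; Inverse)
open import Function.Properties.Inverse using (↔-trans; ↔-sym)
open import Function.Properties.Equivalence using () renaming (trans to ⇔-trans)
open import Function.Related.Propositional using (equivalence)
open import Function.Related.TypeIsomorphisms using (¬-cong-⇔)
open import Induction.WellFounded using (Acc; acc)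
open import Relation.Binary using (tri<; tri≈; tri>)
open import Relation.Binary.Definitions using (_Respects₂_)
open import Relation.Binary.Structures using (IsEquivalence)
open import Relation.Binary.PropositionalEquality using (_≡_; refl; sym; trans; cong; subst)
open import Relation.Nullary using (¬_; yes; no)
open import Relation.Nullary.Decidable using (True; isYes; toWitness; fromWitness; decidable-stable)

open Equivalence using (to; from)

-- Lists, pairing and finite sets

nth : {A : Set} → A → List A → ℕ → A
nth d []       _       = d
nth d (x ∷ xs) zero    = x
nth d (x ∷ xs) (suc i) = nth d xs i

nth-∈ : {A : Set} {d : A} {xs : List A} {x : A} → x ∈ xs → Σ ℕ λ i → nth d xs i ≡ x
nth-∈ (here refl) = zero , refl
nth-∈ (there x∈xs) = let (i , nth≡x) = nth-∈ x∈xs in suc i , nth≡x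

nth-map : {A B : Set} {d : A} {d' : B} (g : A → B) (xs : List A) (i : ℕ) →
          i < length xs → nth d' (map g xs) i ≡ g (nth d xs i)
nth-map g (x ∷ xs) zero    _         = refl
nth-map g (x ∷ xs) (suc i) (s≤s i<n) = nth-map g xs i i<n

position : List ℕ → ℕ → ℕ
position []      y = zero
position (z ∷ l) y with y ≟ z
... | yes _ = zero
... | no  _ = suc (position l y)

position-≤ : ∀ l y → position l y ≤ length l
position-≤ []      y = z≤n
position-≤ (z ∷ l) y with y ≟ z
... | yes _ = z≤n
... | no  _ = s≤s (position-≤ l y)

position-< : ∀ l {y} → y ∈ l → position l y < length l
position-< (z ∷ l) {y} y∈ with y ≟ z | y∈
... | yes _   | _          = s≤s z≤n
... | no  y≢z | here y≡z   = ⊥-elim (y≢z y≡z)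
... | no  _   | there y∈l  = s≤s (position-< l y∈l)

nth-position : ∀ {d} l {y} → y ∈ l → nth d l (position l y) ≡ y
nth-position (z ∷ l) {y} y∈ with y ≟ z | y∈
... | yes y≡z | _          = sym y≡z
... | no  y≢z | here y≡z   = ⊥-elim (y≢z y≡z)
... | no  _   | there y∈l  = nth-position l y∈l

unpair-step : ℕ × ℕ → ℕ × ℕ
unpair-step (zero  , b) = suc b , zero
unpair-step (suc a , b) = a , suc b

-- Inverse of the Cantor pairing: walks the diagonals a + b = d from (d , 0) down to (0 , d).
unpair : ℕ → ℕ × ℕ
unpair zero    = zero , zero
unpair (suc n) = unpair-step (unpair n)

unpair-≤ : ∀ n → proj₁ (unpair n) + proj₂ (unpair n) ≤ n
unpair-≤ zero    = z≤n
unpair-≤ (suc n) = step (unpair n) (unpair-≤ n)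
  where
  step : ∀ p → proj₁ p + proj₂ p ≤ n → proj₁ (unpair-step p) + proj₂ (unpair-step p) ≤ suc n
  step (zero  , b) b≤n   = s≤s (subst (_≤ n) (sym (+-identityʳ b)) b≤n)
  step (suc a , b) a+b<n = subst (_≤ suc n) (sym (+-suc a b)) (≤-trans a+b<n (n≤1+n n))

unpair-walk : ∀ a b n → unpair n ≡ (a + b , 0) → Σ ℕ λ m → unpair m ≡ (a , b)
unpair-walk a zero    n un≡ = n , trans un≡ (cong (_, 0) (+-identityʳ a))
unpair-walk a (suc b) n un≡ =
  let (m , um≡) = unpair-walk (suc a) b n (trans un≡ (cong (_, 0) (+-suc a b)))
  in suc m , cong unpair-step um≡

unpair-diagonal : ∀ d → Σ ℕ λ n → unpair n ≡ (d , 0)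
unpair-diagonal zero    = zero , refl
unpair-diagonal (suc d) =
  let (m , um≡) = uncurry (unpair-walk 0 d) (unpair-diagonal d) in suc m , cong unpair-step um≡

unpair-surjective : ∀ a b → Σ ℕ λ n → unpair n ≡ (a , b)
unpair-surjective a b = uncurry (unpair-walk a b) (unpair-diagonal (a + b))

decodeList : ℕ → ℕ → List ℕ
decodeList zero    c = []
decodeList (suc L) c = proj₁ (unpair c) ∷ decodeList L (proj₂ (unpair c))

decodeList-≤ : ∀ L c → All (_≤ c) (decodeList L c)
decodeList-≤ zero    c = []
decodeList-≤ (suc L) c =
  m+n≤o⇒m≤o _ (unpair-≤ c) ∷ All.map (λ i≤ → ≤-trans i≤ (m+n≤o⇒n≤o _ (unpair-≤ c))) (decodeList-≤ L _)

decodeList-surjective : ∀ l → Σ ℕ λ c → decodeList (length l) c ≡ l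
decodeList-surjective []      = zero , refl
decodeList-surjective (a ∷ l) =
  let (c , dc≡l) = decodeList-surjective l ; (n , un≡) = unpair-surjective a c
  in n , subst (λ p → proj₁ p ∷ decodeList (length l) (proj₂ p) ≡ a ∷ l) (sym un≡) (cong (a ∷_) dc≡l)

T↔Fin : ∀ b → T b ↔ Fin (if b then 1 else 0)
T↔Fin true  = ↔-sym 1↔⊤
T↔Fin false = ↔-sym 0↔⊥

bounded-subset-finite : ∀ n (P : ℕ → Bool) → (∀ m → n ≤ m → ¬ T (P m)) →
                        Σ ℕ λ k → Σ ℕ (T ∘ P) ↔ Fin k
bounded-subset-finite zero P bounded =
  0 , mk↔ₛ′ (λ (m , p) → ⊥-elim (bounded m z≤n p)) (λ ()) (λ ()) (λ (m , p) → ⊥-elim (bounded m z≤n p))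
bounded-subset-finite (suc n) P bounded =
  let (k , tail↔k) = bounded-subset-finite n (P ∘ suc) (λ m n≤m → bounded (suc m) (s≤s n≤m))
  in (if P 0 then 1 else 0) + k , ↔-trans split (↔-trans (T↔Fin (P 0) ⊎-↔ tail↔k) (↔-sym +↔⊎))
  where
  split : Σ ℕ (T ∘ P) ↔ (T (P 0) ⊎ Σ ℕ (T ∘ P ∘ suc))
  split = mk↔ₛ′ (λ { (zero , p) → inj₁ p ; (suc m , p) → inj₂ (m , p) })
                (λ { (inj₁ p) → zero , p ; (inj₂ (m , p)) → suc m , p })
                (λ { (inj₁ p) → refl ; (inj₂ (m , p)) → refl })
                (λ { (zero , p) → refl ; (suc m , p) → refl })

module FiniteEnumeration {A : Set} {n : ℕ} (A↔Fin : A ↔ Fin (suc n)) where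
  open Inverse A↔Fin using (strictlyInverseʳ) renaming (to to index; from to element)

  clamp : ℕ → Fin (suc n)
  clamp k with k <? suc n
  ... | yes k<1+n = fromℕ< k<1+n
  ... | no _      = Fin.zero

  enum : ℕ → A
  enum = element ∘ clamp

  enum-surjective : ∀ c → Σ ℕ λ k → enum k ≡ c
  enum-surjective c = toℕ (index c) , trans (cong element (clamp-toℕ (index c))) (strictlyInverseʳ c)
    where
    clamp-toℕ : ∀ i → clamp (toℕ i) ≡ i
    clamp-toℕ i with toℕ i <? suc n
    ... | yes i<1+n = fromℕ<-toℕ i i<1+n
    ... | no  i≮1+n = ⊥-elim (i≮1+n (toℕ<n i))

  enum-eventually-constant : ∀ k → suc n ≤ k → enum k ≡ enum 0
  enum-eventually-constant k n<k with k <? suc n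
  ... | yes k<1+n = ⊥-elim (≤⇒≯ n<k k<1+n)
  ... | no _      = refl

unique-lookup-injective : {A : Set} {xs : List A} → Unique xs → ∀ i j → lookup xs i ≡ lookup xs j → i ≡ j
unique-lookup-injective (x∉ ∷ _) Fin.zero    Fin.zero    _  = refl
unique-lookup-injective (x∉ ∷ _) Fin.zero    (Fin.suc j) x≡ = ⊥-elim (All.lookup x∉ (∈-lookup j) x≡)
unique-lookup-injective (x∉ ∷ _) (Fin.suc i) Fin.zero    x≡ =
  ⊥-elim (All.lookup x∉ (∈-lookup i) (sym x≡))
unique-lookup-injective (_ ∷ u)  (Fin.suc i) (Fin.suc j) x≡ =
  cong Fin.suc (unique-lookup-injective u i j x≡)

unique-bounded-length : ∀ {n} {xs : List ℕ} → Unique xs → All (_< n) xs → length xs ≤ n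
unique-bounded-length {xs = xs} u bounded = injective⇒≤ injective
  where
  below : Fin (length xs) → Fin _
  below i = fromℕ< (All.lookup bounded (∈-lookup i))
  injective : ∀ {i j} → below i ≡ below j → i ≡ j
  injective {i} {j} bi≡bj = unique-lookup-injective u i j
    (trans (sym (toℕ-fromℕ< _)) (trans (cong toℕ bi≡bj) (toℕ-fromℕ< _)))

module _ {A : Set} where
  -- Indices past the end read the last entry.
  _!_ : ∀ {n} → Vec A (suc n) → ℕ → A
  (x ∷ xs)  ! zero              = x
  _!_ {zero}  (x ∷ xs) (suc i) = x
  _!_ {suc n} (x ∷ xs) (suc i) = xs ! i

  setAt : ∀ {n} → Vec A (suc n) → ℕ → A → Vec A (suc n)
  setAt         (x ∷ xs) zero    a = a ∷ xs
  setAt {zero}  (x ∷ xs) (suc i) a = x ∷ xs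
  setAt {suc n} (x ∷ xs) (suc i) a = x ∷ setAt xs i a

  !-setAt : ∀ {n} (p : Vec A (suc n)) {i} a → i ≤ n → setAt p i a ! i ≡ a
  !-setAt         (x ∷ xs) {zero}  a _         = refl
  !-setAt {suc n} (x ∷ xs) {suc i} a (s≤s i≤n) = !-setAt xs a i≤n

  !-setAt-< : ∀ {n} (p : Vec A (suc n)) {i j} a → j < i → setAt p i a ! j ≡ p ! j
  !-setAt-< {zero}  (x ∷ xs) {suc i} {zero}  a _         = refl
  !-setAt-< {suc n} (x ∷ xs) {suc i} {zero}  a _         = refl
  !-setAt-< {zero}  (x ∷ xs) {suc i} {suc j} a _         = refl
  !-setAt-< {suc n} (x ∷ xs) {suc i} {suc j} a (s≤s j<i) = !-setAt-< xs a j<i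

  tabulateℕ : (ℕ → A) → (n : ℕ) → Vec A (suc n)
  tabulateℕ g zero    = g zero ∷ []
  tabulateℕ g (suc n) = g zero ∷ tabulateℕ (g ∘ suc) n

  !-tabulateℕ : ∀ g n {i} → i ≤ n → tabulateℕ g n ! i ≡ g i
  !-tabulateℕ g zero    {zero}  _         = refl
  !-tabulateℕ g (suc n) {zero}  _         = refl
  !-tabulateℕ g (suc n) {suc i} (s≤s i≤n) = !-tabulateℕ (g ∘ suc) n i≤n

  Vec↔Fin^ : ∀ {n} → A ↔ Fin n → ∀ k → Vec A k ↔ Fin (n ^ k)
  Vec↔Fin^ A↔n zero =
    mk↔ₛ′ (λ _ → Fin.zero) (λ _ → []) (λ { Fin.zero → refl ; (Fin.suc ()) }) (λ { [] → refl })
  Vec↔Fin^ {n} A↔n (suc k) =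
    ↔-trans (mk↔ₛ′ uncons (uncurry _∷_) (λ _ → refl) (λ { (x ∷ xs) → refl }))
            (↔-trans (A↔n ×-↔ Vec↔Fin^ A↔n k) (↔-sym (*↔× {n} {n ^ k})))

-- Structures with an arbitrary interpretation of equality

symbols : Fm → List Sym
symbols (atom a x y) = a ∷ []
symbols (eq x y)     = []
symbols (neg φ)      = symbols φ
symbols (conj φ ψ)   = symbols φ ++ symbols ψ
symbols (ex x φ)     = symbols φ

existentials : Fm → List (Var × Fm)
existentials (atom a x y) = []
existentials (eq x y)     = []
existentials (neg φ)      = existentials φ
existentials (conj φ ψ)   = existentials φ ++ existentials ψ
existentials (ex x φ)     = (x , φ) ∷ existentials φ

existential-⊆ : ∀ φ {x χ} → (x , χ) ∈ existentials φ →
                symbols χ ⊆ symbols φ × vars χ ⊆ vars φ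
existential-⊆ (neg φ) m = existential-⊆ φ m
existential-⊆ (conj φ ψ) m with ∈-++⁻ (existentials φ) m
... | inj₁ m = let (s , v) = existential-⊆ φ m in ∈-++⁺ˡ ∘ s , ∈-++⁺ˡ ∘ v
... | inj₂ m = let (s , v) = existential-⊆ ψ m in ∈-++⁺ʳ (symbols φ) ∘ s , ∈-++⁺ʳ (vars φ) ∘ v
existential-⊆ (ex y φ) (here refl) = id , there
existential-⊆ (ex y φ) (there m) = let (s , v) = existential-⊆ φ m in s , there ∘ v

update-pointwise : {A B : Set} (_∼_ : A → B → Set) {S : Var → Set} {τ : Var → A} {τ' : Var → B}
                   (x : Var) {d : A} {d' : B} → d ∼ d' → (∀ y → S y → τ y ∼ τ' y) →
                   ∀ y → S y → update τ x d y ∼ update τ' x d' y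
update-pointwise _∼_ x d∼d' τ∼τ' y s with y ≡ᵇ x
... | true  = d∼d'
... | false = τ∼τ' y s

record EqStructure : Set₁ where
  field
    Dom : Set
    R   : Sym → Dom → Dom → Set
    E   : Dom → Dom → Set
open EqStructure

⟦_⟧ᵉ : Fm → (M : EqStructure) → (Var → Dom M) → Set
⟦ atom a x y ⟧ᵉ M ρ = R M a (ρ x) (ρ y)
⟦ eq x y ⟧ᵉ     M ρ = E M (ρ x) (ρ y)
⟦ neg φ ⟧ᵉ      M ρ = ¬ ⟦ φ ⟧ᵉ M ρ
⟦ conj φ ψ ⟧ᵉ   M ρ = ⟦ φ ⟧ᵉ M ρ × ⟦ ψ ⟧ᵉ M ρ
⟦ ex x φ ⟧ᵉ     M ρ = Σ (Dom M) λ d → ⟦ φ ⟧ᵉ M (update ρ x d)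

Congruence : EqStructure → Fm → Set
Congruence M φ = ∀ {a} → a ∈ symbols φ → R M a Respects₂ E M

resp₂-both : {A : Set} {P _≈_ : A → A → Set} → P Respects₂ _≈_ →
             ∀ {x x' y y'} → x ≈ x' → y ≈ y' → P x y → P x' y'
resp₂-both (respʳ , respˡ) x≈x' y≈y' = respʳ y≈y' ∘ respˡ x≈x'

module _ (M : EqStructure) (isEq : IsEquivalence (E M)) where
  open IsEquivalence isEq using () renaming (refl to E-refl; sym to E-sym; trans to E-trans)

  ⟦⟧ᵉ-resp : ∀ ψ → Congruence M ψ → {τ τ' : Var → Dom M} →
             (∀ y → y ∈ vars ψ → E M (τ y) (τ' y)) → ⟦ ψ ⟧ᵉ M τ ⇔ ⟦ ψ ⟧ᵉ M τ'
  ⟦⟧ᵉ-resp (atom a x y) c τ≈τ' = mk⇔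
    (resp₂-both (c (here refl)) τx≈ τy≈)
    (resp₂-both (c (here refl)) (E-sym τx≈) (E-sym τy≈))
    where τx≈ = τ≈τ' x (here refl) ; τy≈ = τ≈τ' y (there (here refl))
  ⟦⟧ᵉ-resp (eq x y) c τ≈τ' = mk⇔
    (λ e → E-trans (E-sym τx≈) (E-trans e τy≈))
    (λ e → E-trans τx≈ (E-trans e (E-sym τy≈)))
    where τx≈ = τ≈τ' x (here refl) ; τy≈ = τ≈τ' y (there (here refl))
  ⟦⟧ᵉ-resp (neg ψ) c τ≈τ' = ¬-cong-⇔ (⟦⟧ᵉ-resp ψ c τ≈τ')
  ⟦⟧ᵉ-resp (conj φ ψ) c τ≈τ' =
    ⟦⟧ᵉ-resp φ (c ∘ ∈-++⁺ˡ) (λ y → τ≈τ' y ∘ ∈-++⁺ˡ)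
      ×-⇔ ⟦⟧ᵉ-resp ψ (c ∘ ∈-++⁺ʳ (symbols φ)) (λ y → τ≈τ' y ∘ ∈-++⁺ʳ (vars φ))
  ⟦⟧ᵉ-resp (ex x ψ) c τ≈τ' =
    congˡ {k = equivalence} (⟦⟧ᵉ-resp ψ c (update-pointwise (E M) x E-refl (λ y → τ≈τ' y ∘ there)))

toEq : Structure → EqStructure
toEq 𝔄 = record { Dom = Carrier 𝔄 ; R = rel 𝔄 ; E = _≡_ }

⟦⟧⇔⟦⟧ᵉ : ∀ 𝔄 ψ (ρ : Var → Carrier 𝔄) → ⟦ ψ ⟧ 𝔄 ρ ⇔ ⟦ ψ ⟧ᵉ (toEq 𝔄) ρ
⟦⟧⇔⟦⟧ᵉ 𝔄 (atom a x y) ρ = mk⇔ id id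
⟦⟧⇔⟦⟧ᵉ 𝔄 (eq x y)     ρ = mk⇔ id id
⟦⟧⇔⟦⟧ᵉ 𝔄 (neg ψ)      ρ = ¬-cong-⇔ (⟦⟧⇔⟦⟧ᵉ 𝔄 ψ ρ)
⟦⟧⇔⟦⟧ᵉ 𝔄 (conj φ ψ)   ρ = ⟦⟧⇔⟦⟧ᵉ 𝔄 φ ρ ×-⇔ ⟦⟧⇔⟦⟧ᵉ 𝔄 ψ ρ
⟦⟧⇔⟦⟧ᵉ 𝔄 (ex x ψ)     ρ = congˡ {k = equivalence} (⟦⟧⇔⟦⟧ᵉ 𝔄 ψ (update ρ x _))

record IsEmbedding (M M' : EqStructure) (h : Dom M → Dom M') : Set where
  field
    R-iff : ∀ a u v → R M a u v ⇔ R M' a (h u) (h v)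
    E-iff : ∀ u v → E M u v ⇔ E M' (h u) (h v)

TarskiVaught : (M M' : EqStructure) → (Dom M → Dom M') → Fm → Set
TarskiVaught M M' h φ = ∀ {x χ} → (x , χ) ∈ existentials φ →
  ∀ (τ : Var → Dom M) (τ' : Var → Dom M') → (∀ y → h (τ y) ≡ τ' y) →
  Σ (Dom M') (λ c → ⟦ χ ⟧ᵉ M' (update τ' x c)) → Σ (Dom M) (λ c → ⟦ χ ⟧ᵉ M' (update τ' x (h c)))

module _ {M M' : EqStructure} {h : Dom M → Dom M'} (emb : IsEmbedding M M' h) where
  open IsEmbedding emb

  embedding-⟦⟧ᵉ : ∀ ψ → TarskiVaught M M' h ψ → (τ : Var → Dom M) (τ' : Var → Dom M') →
                  (∀ y → h (τ y) ≡ τ' y) → ⟦ ψ ⟧ᵉ M τ ⇔ ⟦ ψ ⟧ᵉ M' τ'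
  embedding-⟦⟧ᵉ (atom a x y) tv τ τ' hτ≡τ' rewrite sym (hτ≡τ' x) | sym (hτ≡τ' y) = R-iff a (τ x) (τ y)
  embedding-⟦⟧ᵉ (eq x y)     tv τ τ' hτ≡τ' rewrite sym (hτ≡τ' x) | sym (hτ≡τ' y) = E-iff (τ x) (τ y)
  embedding-⟦⟧ᵉ (neg ψ)      tv τ τ' hτ≡τ' = ¬-cong-⇔ (embedding-⟦⟧ᵉ ψ tv τ τ' hτ≡τ')
  embedding-⟦⟧ᵉ (conj φ ψ)   tv τ τ' hτ≡τ' =
    embedding-⟦⟧ᵉ φ (tv ∘ ∈-++⁺ˡ) τ τ' hτ≡τ'
      ×-⇔ embedding-⟦⟧ᵉ ψ (tv ∘ ∈-++⁺ʳ (existentials φ)) τ τ' hτ≡τ'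
  embedding-⟦⟧ᵉ (ex x ψ)     tv τ τ' hτ≡τ' = mk⇔
    (λ (d , p) → h d , to (body d) p)
    (λ w → let (d , p) = tv (here refl) τ τ' hτ≡τ' w in d , from (body d) p)
    where
    body : ∀ d → ⟦ ψ ⟧ᵉ M (update τ x d) ⇔ ⟦ ψ ⟧ᵉ M' (update τ' x (h d))
    body d = embedding-⟦⟧ᵉ ψ (tv ∘ there) (update τ x d) (update τ' x (h d))
               (λ y → update-pointwise (λ u v → h u ≡ v) {S = λ _ → ⊤} x refl (λ y _ → hτ≡τ' y) y tt)

  section⇒TarskiVaught : (s : Dom M' → Dom M) → (∀ c → h (s c) ≡ c) → ∀ φ → TarskiVaught M M' h φ
  section⇒TarskiVaught s hs φ {x} {χ} _ _ τ' _ (c , p) =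
    s c , subst (λ c → ⟦ χ ⟧ᵉ M' (update τ' x c)) (sym (hs c)) p

-- Quotients and countable hulls

-- Canonicity is wrapped in True to make its proofs irrelevant: _≡_ on Index is the quotient equality.
module Quotient (lem : ExcludedMiddle 0ℓ) (M : EqStructure) (isEq : IsEquivalence (E M))
                (e : ℕ → Dom M) where
  open IsEquivalence isEq using ()
    renaming (refl to E-refl; sym to E-sym; trans to E-trans; reflexive to E-reflexive)

  Canonical : ℕ → Set
  Canonical n = ∀ m → m < n → ¬ E M (e m) (e n)

  Index : Set
  Index = Σ ℕ λ n → True (lem {Canonical n})

  elem : Index → Dom M
  elem = e ∘ proj₁

  quotient : Structure
  quotient = record { Carrier = Index ; rel = λ a u v → R M a (elem u) (elem v) }

  canonical-representative : ∀ k → Acc _<_ k → Σ ℕ λ n → Canonical n × E M (e n) (e k)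
  canonical-representative k (acc rs) with lem {Σ ℕ λ m → m < k × E M (e m) (e k)}
  ... | yes (m , m<k , em≈ek) =
    let (n , canonical , en≈em) = canonical-representative m (rs m<k)
    in n , canonical , E-trans en≈em em≈ek
  ... | no ∄ = k , (λ m m<k em≈ek → ∄ (m , m<k , em≈ek)) , E-refl

  class : ∀ k → Σ Index λ u → E M (elem u) (e k)
  class k = let (n , canonical , en≈ek) = canonical-representative k (<-wellFounded k)
            in (n , fromWitness canonical) , en≈ek

  elem-injective : ∀ u v → E M (elem u) (elem v) → u ≡ v
  elem-injective (n , p) (m , q) en≈em with <-cmp n m
  ... | tri< n<m _ _ = ⊥-elim (toWitness q n n<m en≈em)
  ... | tri> _ _ m<n = ⊥-elim (toWitness p m m<n (E-sym en≈em))
  ... | tri≈ _ refl _ = cong (n ,_) (T-irrelevant p q)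

  elem-embedding : IsEmbedding (toEq quotient) M elem
  elem-embedding = record
    { R-iff = λ _ _ _ → mk⇔ id id
    ; E-iff = λ u v → mk⇔ (E-reflexive ∘ cong elem) (elem-injective u v) }

  WitnessClosed : Fm → Set
  WitnessClosed φ = ∀ {x χ} → (x , χ) ∈ existentials φ → (ι : Var → ℕ) →
    Σ (Dom M) (λ c → ⟦ χ ⟧ᵉ M (update (e ∘ ι) x c)) → Σ ℕ λ k → ⟦ χ ⟧ᵉ M (update (e ∘ ι) x (e k))

  Covers : (Var → Dom M) → Set
  Covers ρ = ∀ y → Σ ℕ λ k → E M (e k) (ρ y)

  quotient-TarskiVaught : ∀ φ → Congruence M φ → WitnessClosed φ → TarskiVaught (toEq quotient) M elem φ
  quotient-TarskiVaught φ cφ closed {x} {χ} m τ τ' elemτ≡τ' (c , ⊨χ) =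
    let (k , ⊨χk) = closed m (proj₁ ∘ τ) (c , to (⟦⟧ᵉ-resp M isEq χ cχ
                      (update-pointwise (E M) x E-refl (λ y _ → E-reflexive (sym (elemτ≡τ' y))))) ⊨χ)
        (u , eu≈ek) = class k
    in u , to (⟦⟧ᵉ-resp M isEq χ cχ
             (update-pointwise (E M) x (E-sym eu≈ek) (λ y _ → E-reflexive (elemτ≡τ' y)))) ⊨χk
    where
    cχ : Congruence M χ
    cχ = cφ ∘ proj₁ (existential-⊆ φ m)

  quotient-satisfies : ∀ φ → Congruence M φ → WitnessClosed φ → (ρ : Var → Dom M) → Covers ρ →
                       ⟦ φ ⟧ᵉ M ρ → Σ (Var → Index) λ τ → ⟦ φ ⟧ quotient τ
  quotient-satisfies φ cφ closed ρ covers ⊨φ =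
    τ , from (⟦⟧⇔⟦⟧ᵉ quotient φ τ)
          (from (embedding-⟦⟧ᵉ elem-embedding φ (quotient-TarskiVaught φ cφ closed)
                                τ (elem ∘ τ) (λ _ → refl))
            (to (⟦⟧ᵉ-resp M isEq φ cφ ρ≈elemτ) ⊨φ))
    where
    τ : Var → Index
    τ = proj₁ ∘ class ∘ proj₁ ∘ covers
    ρ≈elemτ : ∀ y → y ∈ vars φ → E M (ρ y) (elem (τ y))
    ρ≈elemτ y _ = E-sym (E-trans (proj₂ (class (proj₁ (covers y)))) (proj₂ (covers y)))

  Surjective : Set
  Surjective = ∀ c → Σ ℕ λ k → e k ≡ c

  surjective⇒WitnessClosed : Surjective → ∀ φ → WitnessClosed φ
  surjective⇒WitnessClosed surj φ {x} {χ} _ ι (c , ⊨χ) =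
    let (k , ek≡c) = surj c in k , subst (λ c → ⟦ χ ⟧ᵉ M (update (e ∘ ι) x c)) (sym ek≡c) ⊨χ

  surjective⇒Covers : Surjective → ∀ ρ → Covers ρ
  surjective⇒Covers surj ρ y = let (k , ek≡ρy) = surj (ρ y) in k , E-reflexive ek≡ρy

  eventually-constant⇒Index-finite : ∀ n → (∀ k → suc n ≤ k → e k ≡ e 0) → Σ ℕ λ m → Index ↔ Fin m
  eventually-constant⇒Index-finite n constant =
    bounded-subset-finite (suc n) (λ m → isYes (lem {Canonical m})) noncanonical
    where
    noncanonical : ∀ m → suc n ≤ m → ¬ T (isYes (lem {Canonical m}))
    noncanonical (suc m) n<m canonical =
      toWitness canonical 0 (s≤s z≤n) (E-reflexive (sym (constant (suc m) n<m)))

module Hull (lem : ExcludedMiddle 0ℓ) (M : EqStructure) (isEq : IsEquivalence (E M))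
            (φ : Fm) (cφ : Congruence M φ) (ρ : Var → Dom M) where
  open IsEquivalence isEq using () renaming (refl to E-refl; reflexive to E-reflexive)

  witness : Var → Fm → (Var → Dom M) → Dom M
  witness x χ τ with lem {Σ (Dom M) λ c → ⟦ χ ⟧ᵉ M (update τ x c)}
  ... | yes (c , _) = c
  ... | no  _       = ρ 0

  witness-sound : ∀ x χ τ → Σ (Dom M) (λ c → ⟦ χ ⟧ᵉ M (update τ x c)) →
                  ⟦ χ ⟧ᵉ M (update τ x (witness x χ τ))
  witness-sound x χ τ w with lem {Σ (Dom M) λ c → ⟦ χ ⟧ᵉ M (update τ x c)}
  ... | yes (_ , ⊨χ) = ⊨χ
  ... | no  ∄        = ⊥-elim (∄ w)

  decodeAssignment : (ℕ → Dom M) → ℕ → Var → Dom M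
  decodeAssignment f code y = f (nth 0 (decodeList (length (vars φ)) code) (position (vars φ) y))

  -- Request (0 , y) asks for ρ y; request (suc j , code) asks for a witness of the
  -- j-th existential subformula under the assignment encoded by code.
  serve : (ℕ → Dom M) → ℕ × ℕ → Dom M
  serve f (zero  , y)    = ρ y
  serve f (suc j , code) = witness (proj₁ χj) (proj₂ χj) (decodeAssignment f code)
    where χj = nth (0 , φ) (existentials φ) j

  -- Course-of-values recursion: approx n is the enumeration as known after n stages.
  approx : ℕ → ℕ → Dom M
  approx zero    i = ρ 0
  approx (suc n) i with i ≟ suc n
  ... | yes _ = serve (approx n) (unpair n)
  ... | no  _ = approx n i

  enum : ℕ → Dom M
  enum n = approx n n

  enum-suc : ∀ n → enum (suc n) ≡ serve (approx n) (unpair n)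
  enum-suc n with suc n ≟ suc n
  ... | yes _ = refl
  ... | no  ≢ = ⊥-elim (≢ refl)

  approx-stable : ∀ n i → i ≤ n → approx n i ≡ enum i
  approx-stable zero    zero z≤n = refl
  approx-stable (suc n) i i≤1+n with i ≟ suc n
  ... | yes refl = sym (enum-suc n)
  ... | no  i≢   = approx-stable n i (s≤s⁻¹ (≤∧≢⇒< i≤1+n i≢))

  open Quotient lem M isEq enum using (Covers; WitnessClosed)

  enum-covers : Covers ρ
  enum-covers y =
    let (n , un≡) = unpair-surjective 0 y
    in suc n , E-reflexive (trans (enum-suc n) (cong (serve (approx n)) un≡))

  encodeAssignment : (ι : Var → ℕ) → Σ ℕ λ code → ∀ n → code ≤ n →
                     ∀ y → y ∈ vars φ → decodeAssignment (approx n) code y ≡ enum (ι y)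
  encodeAssignment ι = code , agrees
    where
    Vs = vars φ
    code = proj₁ (decodeList-surjective (map ι Vs))
    decoded : decodeList (length Vs) code ≡ map ι Vs
    decoded = subst (λ L → decodeList L code ≡ map ι Vs) (length-map ι Vs)
                    (proj₂ (decodeList-surjective (map ι Vs)))
    agrees : ∀ n → code ≤ n → ∀ y → y ∈ Vs → decodeAssignment (approx n) code y ≡ enum (ι y)
    agrees n code≤n y y∈ =
      trans (cong (approx n) entry≡ιy) (approx-stable n (ι y) (≤-trans ιy≤code code≤n))
      where
      entry≡ιy : nth 0 (decodeList (length Vs) code) (position Vs y) ≡ ι y
      entry≡ιy = trans (cong (λ l → nth 0 l (position Vs y)) decoded)
                       (trans (nth-map {d = 0} ι Vs _ (position-< Vs y∈)) (cong ι (nth-position Vs y∈)))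
      ιy≤code : ι y ≤ code
      ιy≤code = All.lookup (subst (All (_≤ code)) decoded (decodeList-≤ _ code)) (∈-map⁺ ι y∈)

  enum-witness-closed : WitnessClosed φ
  enum-witness-closed {x} {χ} x,χ∈ ι (c , ⊨χ) =
    suc n , from (χ-resp (enum (suc n)))
                 (subst (λ d → ⟦ χ ⟧ᵉ M (update τ x d)) (sym enum-suc-n)
                        (witness-sound x χ τ (c , to (χ-resp c) ⊨χ)))
    where
    j = proj₁ (nth-∈ {d = 0 , φ} x,χ∈)
    code = proj₁ (encodeAssignment ι)
    n = proj₁ (unpair-surjective (suc j) code)
    un≡ : unpair n ≡ (suc j , code)
    un≡ = proj₂ (unpair-surjective (suc j) code)
    τ = decodeAssignment (approx n) code
    code≤n : code ≤ n
    code≤n = subst (λ p → proj₂ p ≤ n) un≡ (m+n≤o⇒n≤o _ (unpair-≤ n))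
    enum-suc-n : enum (suc n) ≡ witness x χ τ
    enum-suc-n = trans (enum-suc n) (trans (cong (serve (approx n)) un≡)
                   (cong (λ (x , χ) → witness x χ τ) (proj₂ (nth-∈ x,χ∈))))
    χ-resp : ∀ d → ⟦ χ ⟧ᵉ M (update (enum ∘ ι) x d) ⇔ ⟦ χ ⟧ᵉ M (update τ x d)
    χ-resp d = ⟦⟧ᵉ-resp M isEq χ (cφ ∘ proj₁ (existential-⊆ φ x,χ∈))
      (update-pointwise (E M) x E-refl (λ y y∈ →
        E-reflexive (sym (proj₂ (encodeAssignment ι) n code≤n y (proj₂ (existential-⊆ φ x,χ∈) y∈)))))

-- The reduction

data Symbol : Set where
  base  : Sym → Symbol
  equal : Symbol
  coord : ℕ → Symbol
  agree : ℕ → Symbol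

code : Symbol → Sym
code equal           = 0
code (base zero)     = 3
code (base (suc a))  = 3 + code (base a)
code (coord zero)    = 1
code (coord (suc i)) = 3 + code (coord i)
code (agree zero)    = 2
code (agree (suc d)) = 3 + code (agree d)

shift : Symbol → Symbol
shift equal     = base 0
shift (base a)  = base (suc a)
shift (coord i) = coord (suc i)
shift (agree d) = agree (suc d)

decode : Sym → Symbol
decode 0 = equal
decode 1 = coord 0
decode 2 = agree 0
decode (suc (suc (suc n))) = shift (decode n)

decode-code : ∀ s → decode (code s) ≡ s
decode-code equal           = refl
decode-code (base zero)     = refl
decode-code (base (suc a))  = cong shift (decode-code (base a))
decode-code (coord zero)    = refl
decode-code (coord (suc i)) = cong shift (decode-code (coord i))
decode-code (agree zero)    = refl
decode-code (agree (suc d)) = cong shift (decode-code (agree d))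

atomₛ : Symbol → Var → Var → Fm
atomₛ s = atom (code s)

data Slot : Set where
  slot₀ slot₁ slot₂ : Slot

var : Slot → Var
var slot₀ = 0
var slot₁ = 1
var slot₂ = 2

next : Slot → Slot
next slot₀ = slot₁
next slot₁ = slot₂
next slot₂ = slot₀

viaCoords : Slot → ℕ → ℕ → Symbol → Fm
viaCoords v i j s =
  ex u (conj (atomₛ (coord i) (var v) u) (ex w (conj (atomₛ (coord j) (var v) w) (atomₛ s u w))))
  where
  u = var (next v)
  w = var (next (next v))

-- σ gives the coordinate of each variable in scope, d the next free coordinate, and v the slot
-- holding the current point.
translate : (Var → ℕ) → ℕ → Slot → Fm → Fm
translate σ d v (atom a x y) = viaCoords v (σ x) (σ y) (base a)
translate σ d v (eq x y)     = viaCoords v (σ x) (σ y) equal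
translate σ d v (neg ψ)      = neg (translate σ d v ψ)
translate σ d v (conj φ ψ)   = conj (translate σ d v φ) (translate σ d v ψ)
translate σ d v (ex x ψ)     =
  ex (var (next v)) (conj (atomₛ (agree d) (var v) (var (next v)))
                          (translate (update σ x d) (suc d) (next v) ψ))

all : Var → Fm → Fm
all x φ = neg (ex x (neg φ))

_⇒_ : Fm → Fm → Fm
φ ⇒ ψ = neg (conj φ (neg ψ))

∀₂ ∀₃ : Fm → Fm
∀₂ φ = all 0 (all 1 φ)
∀₃ φ = all 0 (all 1 (all 2 φ))

_∧*_ : List Fm → Fm → Fm
[]       ∧* ψ = ψ
(φ ∷ φs) ∧* ψ = conj φ (φs ∧* ψ)

equalityAxioms : Fm
equalityAxioms =
  conj (all 0 (≈ 0 0)) (conj (∀₂ (≈ 0 1 ⇒ ≈ 1 0)) (∀₃ (conj (≈ 0 1) (≈ 1 2) ⇒ ≈ 0 2)))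
  where ≈ = atomₛ equal

congruenceAxioms : Sym → Fm
congruenceAxioms a =
  conj (∀₃ (conj (atomₛ (base a) 0 1) (≈ 1 2) ⇒ atomₛ (base a) 0 2))
       (∀₃ (conj (atomₛ (base a) 0 1) (≈ 0 2) ⇒ atomₛ (base a) 2 1))
  where ≈ = atomₛ equal

layerAxioms : ℕ → Fm
layerAxioms i =
  conj (∀₃ (conj (V 0 1) (V 0 2) ⇒ atomₛ equal 1 2))
  (conj (all 0 (ex 1 (V 0 1)))
  (conj (∀₂ (ex 2 (conj (A 0 2) (V 2 1))))
  (conj (∀₂ (A⁺ 0 1 ⇒ A 0 1))
        (∀₃ (conj (A⁺ 0 1) (V 0 2) ⇒ V 1 2)))))
  where
  V = atomₛ (coord i)
  A = atomₛ (agree i)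
  A⁺ = atomₛ (agree (suc i))

layers : Fm → ℕ
layers φ = suc (length (vars φ) + size φ)

translation : Fm → Fm
translation φ = translate (position (vars φ)) (length (vars φ)) slot₀ φ

reduce : Fm → Fm
reduce φ =
  map congruenceAxioms (symbols φ) ∧* (map layerAxioms (downFrom (layers φ)) ∧*
    conj equalityAxioms (translation φ))

∧*-preserves : (Q : Fm → Set) → (∀ {φ ψ} → Q φ → Q ψ → Q (conj φ ψ)) →
               ∀ {φs ψ} → All Q φs → Q ψ → Q (φs ∧* ψ)
∧*-preserves Q conj⁺ []         qψ = qψ
∧*-preserves Q conj⁺ (qφ ∷ qφs) qψ = conj⁺ qφ (∧*-preserves Q conj⁺ qφs qψ)

translate-eqFree : ∀ σ d v ψ → EqFree (translate σ d v ψ)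
translate-eqFree σ d v (atom a x y) = _
translate-eqFree σ d v (eq x y)     = _
translate-eqFree σ d v (neg ψ)      = translate-eqFree σ d v ψ
translate-eqFree σ d v (conj φ ψ)   = translate-eqFree σ d v φ , translate-eqFree σ d v ψ
translate-eqFree σ d v (ex x ψ)     = _ , translate-eqFree (update σ x d) (suc d) (next v) ψ

reduce-eqFree : ∀ φ → EqFree (reduce φ)
reduce-eqFree φ =
  ∧*-preserves EqFree _,_ (map⁺ {f = congruenceAxioms} (All.universal (λ _ → _) (symbols φ)))
    (∧*-preserves EqFree _,_ (map⁺ {f = layerAxioms} (All.universal (λ _ → _) (downFrom (layers φ))))
      (_ , translate-eqFree (position (vars φ)) (length (vars φ)) slot₀ φ))

VarsBelow3 : Fm → Set
VarsBelow3 φ = All (_< 3) (vars φ)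

decideVarsBelow3 : ∀ φ → {True (all? (_<? 3) (vars φ))} → VarsBelow3 φ
decideVarsBelow3 φ {below} = toWitness below

var<3 : ∀ v → var v < 3
var<3 slot₀ = s≤s z≤n
var<3 slot₁ = s≤s (s≤s z≤n)
var<3 slot₂ = s≤s (s≤s (s≤s z≤n))

viaCoords-varsBelow3 : ∀ v i j s → VarsBelow3 (viaCoords v i j s)
viaCoords-varsBelow3 slot₀ i j s = decideVarsBelow3 (viaCoords slot₀ i j s)
viaCoords-varsBelow3 slot₁ i j s = decideVarsBelow3 (viaCoords slot₁ i j s)
viaCoords-varsBelow3 slot₂ i j s = decideVarsBelow3 (viaCoords slot₂ i j s)

translate-varsBelow3 : ∀ σ d v ψ → VarsBelow3 (translate σ d v ψ)
translate-varsBelow3 σ d v (atom a x y) = viaCoords-varsBelow3 v (σ x) (σ y) (base a)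
translate-varsBelow3 σ d v (eq x y)     = viaCoords-varsBelow3 v (σ x) (σ y) equal
translate-varsBelow3 σ d v (neg ψ)    = translate-varsBelow3 σ d v ψ
translate-varsBelow3 σ d v (conj φ ψ) = ++⁺ (translate-varsBelow3 σ d v φ) (translate-varsBelow3 σ d v ψ)
translate-varsBelow3 σ d v (ex x ψ)   =
  var<3 (next v) ∷ var<3 v ∷ var<3 (next v) ∷ translate-varsBelow3 (update σ x d) (suc d) (next v) ψ

reduce-varsBelow3 : ∀ φ → VarsBelow3 (reduce φ)
reduce-varsBelow3 φ =
  ∧*-preserves VarsBelow3 ++⁺
    (map⁺ {f = congruenceAxioms}
      (All.universal (λ a → decideVarsBelow3 (congruenceAxioms a)) (symbols φ)))
    (∧*-preserves VarsBelow3 ++⁺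
      (map⁺ {f = layerAxioms}
        (All.universal (λ i → decideVarsBelow3 (layerAxioms i)) (downFrom (layers φ))))
      (++⁺ (decideVarsBelow3 equalityAxioms)
           (translate-varsBelow3 (position (vars φ)) (length (vars φ)) slot₀ φ)))
reduce-FO3 : ∀ φ → IsFO3NoEq (reduce φ)
reduce-FO3 φ =
  unique-bounded-length (deduplicate-! (vars (reduce φ))) (deduplicate⁺ _≟_ (reduce-varsBelow3 φ)) ,
  reduce-eqFree φ

size-map-∧* : {A : Set} (f : A → Fm) (k : ℕ) → (∀ a → size (f a) ≡ k) →
              ∀ xs ψ → size (map f xs ∧* ψ) ≡ length xs * suc k + size ψ
size-map-∧* f k size≡k []       ψ = refl
size-map-∧* f k size≡k (x ∷ xs) ψ rewrite size≡k x | size-map-∧* f k size≡k xs ψ =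
  cong suc (sym (+-assoc k (length xs * suc k) (size ψ)))

size-translate : ∀ σ d v ψ → size (translate σ d v ψ) ≤ 5 * size ψ
size-translate σ d v (atom a x y) = ≤-refl
size-translate σ d v (eq x y)     = ≤-refl
size-translate σ d v (neg ψ)      = begin
  1 + size (translate σ d v ψ) ≤⟨ +-mono-≤ (m≤m+n 1 4) (size-translate σ d v ψ) ⟩
  5 + 5 * size ψ               ≡⟨ sym (*-suc 5 (size ψ)) ⟩
  5 * size (neg ψ)             ∎
  where open ≤-Reasoning
size-translate σ d v (conj φ ψ)   = begin
  1 + (size (translate σ d v φ) + size (translate σ d v ψ))
    ≤⟨ +-mono-≤ (m≤m+n 1 4) (+-mono-≤ (size-translate σ d v φ) (size-translate σ d v ψ)) ⟩
  5 + (5 * size φ + 5 * size ψ) ≡⟨ arith (size φ) (size ψ) ⟩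
  5 * size (conj φ ψ)           ∎
  where
  open ≤-Reasoning
  arith : ∀ a b → 5 + (5 * a + 5 * b) ≡ 5 * (1 + a + b)
  arith = solve-∀
size-translate σ d v (ex x ψ)     = begin
  6 + size (translate (update σ x d) (suc d) (next v) ψ)
    ≤⟨ +-mono-≤ (m≤m+n 6 4) (size-translate (update σ x d) (suc d) (next v) ψ) ⟩
  10 + 5 * size ψ ≡⟨ arith (size ψ) ⟩
  5 * size (ex x ψ) ∎
  where
  open ≤-Reasoning
  arith : ∀ a → 10 + 5 * a ≡ 5 * (2 + a)
  arith = solve-∀

length-symbols≤size : ∀ φ → length (symbols φ) ≤ size φ
length-symbols≤size (atom a x y) = s≤s z≤n
length-symbols≤size (eq x y)     = z≤n
length-symbols≤size (neg φ)      = m≤n⇒m≤1+n (length-symbols≤size φ)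
length-symbols≤size (conj φ ψ) rewrite length-++ (symbols φ) {symbols ψ} =
  m≤n⇒m≤1+n (+-mono-≤ (length-symbols≤size φ) (length-symbols≤size ψ))
length-symbols≤size (ex x φ)     = m≤n⇒m≤1+n (m≤n⇒m≤1+n (length-symbols≤size φ))

length-vars≤size : ∀ φ → length (vars φ) ≤ size φ
length-vars≤size (atom a x y) = s≤s (s≤s z≤n)
length-vars≤size (eq x y)     = s≤s (s≤s z≤n)
length-vars≤size (neg φ)      = m≤n⇒m≤1+n (length-vars≤size φ)
length-vars≤size (conj φ ψ) rewrite length-++ (vars φ) {vars ψ} =
  m≤n⇒m≤1+n (+-mono-≤ (length-vars≤size φ) (length-vars≤size ψ))
length-vars≤size (ex x φ)     = s≤s (m≤n⇒m≤1+n (length-vars≤size φ))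

size-reduce : ∀ φ → size (reduce φ) ≤ 253 * size φ + 150
size-reduce φ = begin
  size (reduce φ)
    ≡⟨ size-map-∧* congruenceAxioms 51 (λ _ → refl) (symbols φ) _ ⟩
  length (symbols φ) * 52 + size (map layerAxioms (downFrom (layers φ)) ∧* rest)
    ≡⟨ cong (length (symbols φ) * 52 +_)
            (size-map-∧* layerAxioms 97 (λ _ → refl) (downFrom (layers φ)) rest) ⟩
  length (symbols φ) * 52 + (length (downFrom (layers φ)) * 98 + size rest)
    ≡⟨ cong (λ n → length (symbols φ) * 52 + (n * 98 + size rest)) (length-downFrom (layers φ)) ⟩
  length (symbols φ) * 52 + (layers φ * 98 + (52 + size (translation φ)))
    ≤⟨ +-mono-≤ (*-monoˡ-≤ 52 (length-symbols≤size φ))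
         (+-mono-≤ (*-monoˡ-≤ 98 (s≤s (+-monoˡ-≤ (size φ) (length-vars≤size φ))))
                   (+-monoʳ-≤ 52 (size-translate _ _ slot₀ φ))) ⟩
  size φ * 52 + ((1 + (size φ + size φ)) * 98 + (52 + 5 * size φ))
    ≡⟨ arith (size φ) ⟩
  253 * size φ + 150 ∎
  where
  open ≤-Reasoning
  rest = conj equalityAxioms (translation φ)
  arith : ∀ s → s * 52 + ((1 + (s + s)) * 98 + (52 + 5 * s)) ≡ 253 * s + 150
  arith = solve-∀

-- Semantics of the axioms

all-intro : {A : Set} {P : A → Set} → (∀ a → P a) → ¬ Σ A (λ a → ¬ P a)
all-intro f (a , ¬pa) = ¬pa (f a)

all-elim : ExcludedMiddle 0ℓ → {A : Set} {P : A → Set} → ¬ Σ A (λ a → ¬ P a) → ∀ a → P a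
all-elim lem ∄ a = decidable-stable lem (λ ¬pa → ∄ (a , ¬pa))

⇒-intro : {P Q : Set} → (P → Q) → ¬ (P × ¬ Q)
⇒-intro f (p , ¬q) = ¬q (f p)

⇒-elim : ExcludedMiddle 0ℓ → {P Q : Set} → ¬ (P × ¬ Q) → P → Q
⇒-elim lem ¬[p×¬q] p = decidable-stable lem (λ ¬q → ¬[p×¬q] (p , ¬q))

∀₂⇒-intro : {C : Set} {P Q : C → C → Set} → (∀ p q → P p q → Q p q) →
            ¬ Σ C (λ p → ¬ ¬ Σ C λ q → ¬ ¬ (P p q × ¬ Q p q))
∀₂⇒-intro f = all-intro λ p → all-intro λ q → ⇒-intro (f p q)

∀₃⇒-intro : {C : Set} {P Q : C → C → C → Set} → (∀ p q r → P p q r → Q p q r) →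
            ¬ Σ C (λ p → ¬ ¬ Σ C λ q → ¬ ¬ Σ C λ r → ¬ ¬ (P p q r × ¬ Q p q r))
∀₃⇒-intro f = all-intro λ p → all-intro λ q → all-intro λ r → ⇒-intro (f p q r)

∀₂⇒-elim : ExcludedMiddle 0ℓ → {C : Set} {P Q : C → C → Set} →
           ¬ Σ C (λ p → ¬ ¬ Σ C λ q → ¬ ¬ (P p q × ¬ Q p q)) → ∀ p q → P p q → Q p q
∀₂⇒-elim lem h p q = ⇒-elim lem (all-elim lem (all-elim lem h p) q)

∀₃⇒-elim : ExcludedMiddle 0ℓ → {C : Set} {P Q : C → C → C → Set} →
           ¬ Σ C (λ p → ¬ ¬ Σ C λ q → ¬ ¬ Σ C λ r → ¬ ¬ (P p q r × ¬ Q p q r)) →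
           ∀ p q r → P p q r → Q p q r
∀₃⇒-elim lem h p q r = ⇒-elim lem (all-elim lem (all-elim lem (all-elim lem h p) q) r)

∧*-⇔ : ∀ {𝔅 : Structure} φs ψ β → ⟦ φs ∧* ψ ⟧ 𝔅 β ⇔ (All (λ φ → ⟦ φ ⟧ 𝔅 β) φs × ⟦ ψ ⟧ 𝔅 β)
∧*-⇔ []       ψ β = mk⇔ ([] ,_) proj₂
∧*-⇔ (φ ∷ φs) ψ β = mk⇔
  (λ (⊨φ , ⊨rest) → let (⊨φs , ⊨ψ) = to (∧*-⇔ φs ψ β) ⊨rest in ⊨φ ∷ ⊨φs , ⊨ψ)
  (λ { (⊨φ ∷ ⊨φs , ⊨ψ) → ⊨φ , from (∧*-⇔ φs ψ β) (⊨φs , ⊨ψ) })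

module _ (𝔅 : Structure) where
  Same : Carrier 𝔅 → Carrier 𝔅 → Set
  Same = rel 𝔅 (code equal)

  Base : Sym → Carrier 𝔅 → Carrier 𝔅 → Set
  Base a = rel 𝔅 (code (base a))

  Coord Agree : ℕ → Carrier 𝔅 → Carrier 𝔅 → Set
  Coord i = rel 𝔅 (code (coord i))
  Agree d = rel 𝔅 (code (agree d))

record Layer (𝔅 : Structure) (i : ℕ) : Set where
  field
    coord-functional : ∀ p u w → Coord 𝔅 i p u → Coord 𝔅 i p w → Same 𝔅 u w
    coord-total      : ∀ p → Σ (Carrier 𝔅) (Coord 𝔅 i p)
    coord-update     : ∀ p u → Σ (Carrier 𝔅) λ q → Agree 𝔅 i p q × Coord 𝔅 i q u
    agree-pred       : ∀ p q → Agree 𝔅 (suc i) p q → Agree 𝔅 i p q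
    agree-coord      : ∀ p q u → Agree 𝔅 (suc i) p q → Coord 𝔅 i p u → Coord 𝔅 i q u

record Axioms (𝔅 : Structure) (D : ℕ) (L : List Sym) : Set where
  field
    same-isEquivalence : IsEquivalence (Same 𝔅)
    base-congruent     : ∀ {a} → a ∈ L → Base 𝔅 a Respects₂ Same 𝔅
    layer              : ∀ {i} → i < D → Layer 𝔅 i

module _ (lem : ExcludedMiddle 0ℓ) {𝔅 : Structure} (β : Var → Carrier 𝔅) where
  equality-⇔ : ⟦ equalityAxioms ⟧ 𝔅 β ⇔ IsEquivalence (Same 𝔅)
  equality-⇔ = mk⇔
    (λ (refl′ , sym′ , trans′) → record
      { refl  = λ {u} → all-elim lem refl′ u
      ; sym   = λ {u} {v} → ∀₂⇒-elim lem sym′ u v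
      ; trans = λ {u} {v} {w} u≈v v≈w → ∀₃⇒-elim lem trans′ u v w (u≈v , v≈w) })
    (λ isEq →
      all-intro (λ _ → IsEquivalence.refl isEq) ,
      ∀₂⇒-intro (λ _ _ → IsEquivalence.sym isEq) ,
      ∀₃⇒-intro (λ _ _ _ (u≈v , v≈w) → IsEquivalence.trans isEq u≈v v≈w))

  congruence-⇔ : ∀ a → ⟦ congruenceAxioms a ⟧ 𝔅 β ⇔ (Base 𝔅 a Respects₂ Same 𝔅)
  congruence-⇔ a = mk⇔
    (λ (right , left) → (λ {x} {y} {y'} y≈y' b → ∀₃⇒-elim lem right x y y' (b , y≈y')) ,
                        (λ {y} {x} {x'} x≈x' b → ∀₃⇒-elim lem left x y x' (b , x≈x')))
    (λ (respʳ , respˡ) → ∀₃⇒-intro (λ _ _ _ (b , ≈) → respʳ ≈ b) ,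
                         ∀₃⇒-intro (λ _ _ _ (b , ≈) → respˡ ≈ b))

  layer-⇔ : ∀ i → ⟦ layerAxioms i ⟧ 𝔅 β ⇔ Layer 𝔅 i
  layer-⇔ i = mk⇔
    (λ (functional , total , update′ , pred , keep) → record
      { coord-functional = λ p u w pu pw → ∀₃⇒-elim lem functional p u w (pu , pw)
      ; coord-total      = all-elim lem total
      ; coord-update     = λ p → all-elim lem (all-elim lem update′ p)
      ; agree-pred       = ∀₂⇒-elim lem pred
      ; agree-coord      = λ p q u apq pu → ∀₃⇒-elim lem keep p q u (apq , pu) })
    (λ layer → let open Layer layer in
      ∀₃⇒-intro (λ p u w (pu , pw) → coord-functional p u w pu pw) ,
      all-intro coord-total ,
      all-intro (λ p → all-intro (coord-update p)) ,
      ∀₂⇒-intro agree-pred ,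
      ∀₃⇒-intro (λ p q u (apq , pu) → agree-coord p q u apq pu))

  axioms-⇔ : ∀ L D t →
    ⟦ map congruenceAxioms L ∧* (map layerAxioms (downFrom D) ∧* conj equalityAxioms t) ⟧ 𝔅 β ⇔
    (Axioms 𝔅 D L × ⟦ t ⟧ 𝔅 β)
  axioms-⇔ L D t = mk⇔
    (λ ⊨ax → let (⊨congruence , ⊨rest) = to (∧*-⇔ (map congruenceAxioms L) _ β) ⊨ax
                 (⊨layers , ⊨equality , ⊨t) =
                   to (∧*-⇔ (map layerAxioms (downFrom D)) (conj equalityAxioms t) β) ⊨rest
             in record
                  { same-isEquivalence = to equality-⇔ ⊨equality
                  ; base-congruent = λ {a} a∈L → to (congruence-⇔ a) (All.lookup (map⁻ ⊨congruence) a∈L)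
                  ; layer = λ {i} i<D → to (layer-⇔ i) (All.lookup (map⁻ ⊨layers) (∈-downFrom⁺ i<D)) } ,
                ⊨t)
    (λ (ax , ⊨t) → let open Axioms ax in
      from (∧*-⇔ (map congruenceAxioms L) _ β)
        (map⁺ (All.tabulate λ {a} a∈L → from (congruence-⇔ a) (base-congruent a∈L)) ,
         from (∧*-⇔ (map layerAxioms (downFrom D)) (conj equalityAxioms t) β)
           (map⁺ (All.tabulate λ {i} i∈ → from (layer-⇔ i) (layer (∈-downFrom⁻ i∈))) ,
            from equality-⇔ same-isEquivalence , ⊨t)))

-- Correctness of the translation

underlying : Structure → EqStructure
underlying 𝔅 = record { Dom = Carrier 𝔅 ; R = Base 𝔅 ; E = Same 𝔅 }

viaCoords-⇔ : ∀ {𝔅 : Structure} v i j s β →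
  ⟦ viaCoords v i j s ⟧ 𝔅 β ⇔
  Σ (Carrier 𝔅) λ c → Coord 𝔅 i (β (var v)) c ×
  Σ (Carrier 𝔅) λ w → Coord 𝔅 j (β (var v)) w × rel 𝔅 (code s) c w
viaCoords-⇔ slot₀ i j s β = mk⇔ id id
viaCoords-⇔ slot₁ i j s β = mk⇔ id id
viaCoords-⇔ slot₂ i j s β = mk⇔ id id

guarded-∃-⇔ : ∀ {𝔅 : Structure} v s ψ β →
  ⟦ ex (var (next v)) (conj (atomₛ s (var v) (var (next v))) ψ) ⟧ 𝔅 β ⇔
  Σ (Carrier 𝔅) λ c → rel 𝔅 (code s) (β (var v)) c × ⟦ ψ ⟧ 𝔅 (update β (var (next v)) c)
guarded-∃-⇔ slot₀ s ψ β = mk⇔ id id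
guarded-∃-⇔ slot₁ s ψ β = mk⇔ id id
guarded-∃-⇔ slot₂ s ψ β = mk⇔ id id

update-var-next : {A : Set} (β : Var → A) (v : Slot) (c : A) →
                  update β (var (next v)) c (var (next v)) ≡ c
update-var-next β slot₀ c = refl
update-var-next β slot₁ c = refl
update-var-next β slot₂ c = refl

module Translation {𝔅 : Structure} {D : ℕ} {L : List Sym} (ax : Axioms 𝔅 D L) where
  open Axioms ax
  open Layer
  open IsEquivalence same-isEquivalence using () renaming (sym to ≈-sym; trans to ≈-trans)

  agree-below : ∀ d → d ≤ D → ∀ p q → Agree 𝔅 d p q → ∀ i → i < d → ∀ u → Coord 𝔅 i p u → Coord 𝔅 i q u
  agree-below (suc d) d<D p q apq i i<1+d u pu with m≤n⇒m<n∨m≡n (s≤s⁻¹ i<1+d)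
  ... | inj₁ i<d  = agree-below d (<⇒≤ d<D) p q (agree-pred (layer d<D) p q apq) i i<d u pu
  ... | inj₂ refl = agree-coord (layer d<D) p q u apq pu

  Stores : (Var → ℕ) → ℕ → Carrier 𝔅 → (Var → Carrier 𝔅) → Fm → Set
  Stores σ d p ρ ψ = ∀ y → y ∈ vars ψ → σ y < d × Coord 𝔅 (σ y) p (ρ y)

  stores-update : ∀ {σ d p ρ x ψ c u} → d < D → Stores σ d p ρ (ex x ψ) → Agree 𝔅 d p c → Coord 𝔅 d c u →
                  Stores (update σ x d) (suc d) c (update ρ x u) ψ
  stores-update {σ} {d} {p} {ρ} {x} d<D stored apc cu y y∈ with y ≡ᵇ x
  ... | true  = ≤-refl , cu
  ... | false = let (σy<d , pρy) = stored y (there y∈)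
                in m≤n⇒m≤1+n σy<d , agree-below d (<⇒≤ d<D) p _ apc (σ y) σy<d (ρ y) pρy

  coords-⇔ : ∀ {S : Carrier 𝔅 → Carrier 𝔅 → Set} {i j p u w} → S Respects₂ Same 𝔅 → i < D → j < D →
             Coord 𝔅 i p u → Coord 𝔅 j p w →
             (Σ (Carrier 𝔅) λ c → Coord 𝔅 i p c × Σ (Carrier 𝔅) λ w' → Coord 𝔅 j p w' × S c w') ⇔ S u w
  coords-⇔ S-resp i<D j<D pu pw = mk⇔
    (λ (c , pc , w' , pw' , s) →
      resp₂-both S-resp (coord-functional (layer i<D) _ _ _ pc pu)
                        (coord-functional (layer j<D) _ _ _ pw' pw) s)
    (λ s → _ , pu , _ , pw , s)

  same-respects : Same 𝔅 Respects₂ Same 𝔅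
  same-respects = (λ y≈y' x≈y → ≈-trans x≈y y≈y') , (λ x≈x' x≈y → ≈-trans (≈-sym x≈x') x≈y)

  viaCoords-stored-⇔ : ∀ {σ d v β ρ} s ψ {x y} → rel 𝔅 (code s) Respects₂ Same 𝔅 → d + size ψ ≤ D →
                  x ∈ vars ψ → y ∈ vars ψ → Stores σ d (β (var v)) ρ ψ →
                  ⟦ viaCoords v (σ x) (σ y) s ⟧ 𝔅 β ⇔ rel 𝔅 (code s) (ρ x) (ρ y)
  viaCoords-stored-⇔ {σ} {d} {v} {β} s ψ {x} {y} s-resp bound x∈ y∈ stored =
    ⇔-trans (viaCoords-⇔ {𝔅} v (σ x) (σ y) s β)
            (coords-⇔ s-resp (below x∈) (below y∈) (proj₂ (stored x x∈)) (proj₂ (stored y y∈)))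
    where
    below : ∀ {z} → z ∈ vars ψ → σ z < D
    below z∈ = <-≤-trans (proj₁ (stored _ z∈)) (m+n≤o⇒m≤o d bound)

  translate-⇔ : ∀ ψ σ d v β ρ → d + size ψ ≤ D → symbols ψ ⊆ L → Stores σ d (β (var v)) ρ ψ →
                ⟦ translate σ d v ψ ⟧ 𝔅 β ⇔ ⟦ ψ ⟧ᵉ (underlying 𝔅) ρ
  translate-⇔ ψ@(atom a x y) σ d v β ρ bound ψ⊆L stored =
    viaCoords-stored-⇔ {σ} {d} {v} {β} {ρ} (base a) ψ (base-congruent (ψ⊆L (here refl))) bound
                  (here refl) (there (here refl)) stored
  translate-⇔ ψ@(eq x y) σ d v β ρ bound ψ⊆L stored =
    viaCoords-stored-⇔ {σ} {d} {v} {β} {ρ} equal ψ same-respects bound (here refl) (there (here refl)) stored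
  translate-⇔ (neg ψ) σ d v β ρ bound ψ⊆L stored =
    ¬-cong-⇔ (translate-⇔ ψ σ d v β ρ (≤-trans (+-monoʳ-≤ d (n≤1+n _)) bound) ψ⊆L stored)
  translate-⇔ (conj φ ψ) σ d v β ρ bound ψ⊆L stored =
    translate-⇔ φ σ d v β ρ (≤-trans (+-monoʳ-≤ d (m≤n⇒m≤1+n (m≤m+n _ _))) bound)
                (ψ⊆L ∘ ∈-++⁺ˡ) (λ y → stored y ∘ ∈-++⁺ˡ)
      ×-⇔
    translate-⇔ ψ σ d v β ρ (≤-trans (+-monoʳ-≤ d (m≤n⇒m≤1+n (m≤n+m _ _))) bound)
                (ψ⊆L ∘ ∈-++⁺ʳ _) (λ y → stored y ∘ ∈-++⁺ʳ _)
  translate-⇔ (ex x ψ) σ d v β ρ bound ψ⊆L stored =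
    ⇔-trans (guarded-∃-⇔ {𝔅} v (agree d) ψ' β) (mk⇔
      (λ (c , apc , ⊨ψ') → let (u , cu) = coord-total (layer d<D) c in u , to (body apc cu) ⊨ψ')
      (λ (u , ⊨ψ) → let (c , apc , cu) = coord-update (layer d<D) p u
                    in c , apc , from (body apc cu) ⊨ψ))
    where
    ψ' = translate (update σ x d) (suc d) (next v) ψ
    p = β (var v)
    bound' : suc d + size ψ ≤ D
    bound' = ≤-trans (s≤s (+-monoʳ-≤ d (n≤1+n (size ψ)))) (≤-trans (≤-reflexive (sym (+-suc d _))) bound)
    d<D : d < D
    d<D = ≤-trans (m≤m+n (suc d) (size ψ)) bound'
    body : ∀ {c u} → Agree 𝔅 d p c → Coord 𝔅 d c u →
           ⟦ ψ' ⟧ 𝔅 (update β (var (next v)) c) ⇔ ⟦ ψ ⟧ᵉ (underlying 𝔅) (update ρ x u)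
    body {c} apc cu =
      translate-⇔ ψ (update σ x d) (suc d) (next v) (update β (var (next v)) c) _ bound' ψ⊆L
        (subst (λ q → Stores (update σ x d) (suc d) q _ ψ) (sym (update-var-next β v c))
               (stores-update {σ} {d} {p} {ρ} {x} {ψ} d<D stored apc cu))

-- Models of the reduction

module VectorModel (𝔄 : Structure) (D : ℕ) where
  Point : Set
  Point = Vec (Carrier 𝔄) (suc D)

  interpret : Symbol → Point → Point → Set
  interpret (base a)  p q = rel 𝔄 a (head p) (head q)
  interpret equal     p q = head p ≡ head q
  interpret (coord i) p q = p ! i ≡ head q
  interpret (agree d) p q = ∀ j → j < d → p ! j ≡ q ! j

  vectors : Structure
  vectors = record { Carrier = Point ; rel = interpret ∘ decode }

  rel-code : ∀ s {p q} → rel vectors (code s) p q ⇔ interpret s p q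
  rel-code s {p} {q} = mk⇔ (subst (λ t → interpret t p q) (decode-code s))
                           (subst (λ t → interpret t p q) (sym (decode-code s)))

  vectors-axioms : ∀ L → Axioms vectors D L
  vectors-axioms L = record
    { same-isEquivalence = record { refl = refl ; sym = sym ; trans = trans }
    ; base-congruent     = λ {a} _ → base-respects a
    ; layer              = layer }
    where
    base-respects : ∀ a → Base vectors a Respects₂ Same vectors
    base-respects a =
      (λ {p} hq≡hq' → from base⇔ ∘ subst (rel 𝔄 a (head p)) hq≡hq' ∘ to base⇔) ,
      (λ {q} hp≡hp' → from base⇔ ∘ subst (λ z → rel 𝔄 a z (head q)) hp≡hp' ∘ to base⇔)
      where base⇔ = rel-code (base a)
    layer : ∀ {i} → i < D → Layer vectors i
    layer {i} i<D = record
      { coord-functional = λ p u w pu pw →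
          trans (sym (to (rel-code (coord i)) pu)) (to (rel-code (coord i)) pw)
      ; coord-total      = λ p → replicate (suc D) (p ! i) , from (rel-code (coord i)) refl
      ; coord-update     = λ p u → setAt p i (head u) ,
          from (rel-code (agree i)) (λ j j<i → sym (!-setAt-< p (head u) j<i)) ,
          from (rel-code (coord i)) (!-setAt p (head u) (<⇒≤ i<D))
      ; agree-pred       = λ p q apq → from (rel-code (agree i)) λ j j<i →
          to (rel-code (agree (suc i))) apq j (m≤n⇒m≤1+n j<i)
      ; agree-coord      = λ p q u apq pu → from (rel-code (coord i))
          (trans (sym (to (rel-code (agree (suc i))) apq i ≤-refl)) (to (rel-code (coord i)) pu)) }

  head-embedding : IsEmbedding (underlying vectors) (toEq 𝔄) head
  head-embedding = record { R-iff = λ a _ _ → rel-code (base a) ; E-iff = λ _ _ → mk⇔ id id }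

module _ (lem : ExcludedMiddle 0ℓ) (φ : Fm) where
  position<layers : ∀ y → position (vars φ) y < layers φ
  position<layers y = s≤s (≤-trans (position-≤ (vars φ) y) (m≤m+n _ _))

  module _ (𝔄 : Structure) where
    open VectorModel 𝔄 (layers φ)
    open Translation (vectors-axioms (symbols φ))

    point : (Var → Carrier 𝔄) → Point
    point ρ = tabulateℕ (ρ ∘ nth 0 (vars φ)) (layers φ)

    vectors-⊨-reduce : (ρ : Var → Carrier 𝔄) → ⟦ φ ⟧ 𝔄 ρ → ⟦ reduce φ ⟧ vectors (λ _ → point ρ)
    vectors-⊨-reduce ρ ⊨φ =
      from (axioms-⇔ lem β (symbols φ) (layers φ) (translation φ))
        (vectors-axioms (symbols φ) ,
         from (translate-⇔ φ (position (vars φ)) (length (vars φ)) slot₀ β ρ̂ (n≤1+n _) id stored)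
           (from (embedding-⟦⟧ᵉ head-embedding φ
                    (section⇒TarskiVaught head-embedding (replicate _) (λ _ → refl) φ) ρ̂ ρ (λ _ → refl))
             (to (⟦⟧⇔⟦⟧ᵉ 𝔄 φ ρ) ⊨φ)))
      where
      β : Var → Point
      β _ = point ρ
      ρ̂ : Var → Point
      ρ̂ = replicate _ ∘ ρ
      stored : Stores (position (vars φ)) (length (vars φ)) (point ρ) ρ̂ φ
      stored y y∈ = position-< (vars φ) y∈ , from (rel-code (coord (position (vars φ) y)))
        (trans (!-tabulateℕ (ρ ∘ nth 0 (vars φ)) (layers φ) (<⇒≤ (position<layers y)))
               (cong ρ (nth-position (vars φ) y∈)))

  module _ {𝔅 : Structure} (β : Var → Carrier 𝔅) (⊨reduce : ⟦ reduce φ ⟧ 𝔅 β) where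
    private
      axioms×⊨translation = to (axioms-⇔ lem β (symbols φ) (layers φ) (translation φ)) ⊨reduce
      ax = proj₁ axioms×⊨translation
    open Axioms ax
    open Translation ax

    decoded : Var → Carrier 𝔅
    decoded y = proj₁ (Layer.coord-total (layer (position<layers y)) (β 0))

    decoded-⊨ : ⟦ φ ⟧ᵉ (underlying 𝔅) decoded
    decoded-⊨ =
      to (translate-⇔ φ (position (vars φ)) (length (vars φ)) slot₀ β decoded (n≤1+n _) id stored)
         (proj₂ axioms×⊨translation)
      where
      stored : Stores (position (vars φ)) (length (vars φ)) (β 0) decoded φ
      stored y y∈ = position-< (vars φ) y∈ , proj₂ (Layer.coord-total (layer (position<layers y)) (β 0))

    reduce⇒satisfiable : Satisfiable φ
    reduce⇒satisfiable =
      let (τ , ⊨φ) =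
            quotient-satisfies φ base-congruent enum-witness-closed decoded enum-covers decoded-⊨
      in quotient , τ , ⊨φ
      where
      open Hull lem (underlying 𝔅) same-isEquivalence φ base-congruent decoded
      open Quotient lem (underlying 𝔅) same-isEquivalence enum

    reduce⇒finSatisfiable : IsFinite 𝔅 → FinSatisfiable φ
    reduce⇒finSatisfiable (zero  , 𝔅↔0)   = ⊥-elim (¬Fin0 (Inverse.to 𝔅↔0 (β 0)))
    reduce⇒finSatisfiable (suc n , 𝔅↔1+n) =
      let (τ , ⊨φ) =
            quotient-satisfies φ base-congruent (surjective⇒WitnessClosed enum-surjective φ)
                               decoded (surjective⇒Covers enum-surjective decoded) decoded-⊨
      in quotient , eventually-constant⇒Index-finite n enum-eventually-constant , τ , ⊨φ
      where
      open FiniteEnumeration 𝔅↔1+n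
      open Quotient lem (underlying 𝔅) same-isEquivalence enum

  reduce-satisfiable : Satisfiable φ ⇔ Satisfiable (reduce φ)
  reduce-satisfiable = mk⇔
    (λ (𝔄 , ρ , ⊨φ) → VectorModel.vectors 𝔄 (layers φ) , _ , vectors-⊨-reduce 𝔄 ρ ⊨φ)
    (λ (𝔅 , β , ⊨reduce) → reduce⇒satisfiable β ⊨reduce)

  reduce-finSatisfiable : FinSatisfiable φ ⇔ FinSatisfiable (reduce φ)
  reduce-finSatisfiable = mk⇔
    (λ (𝔄 , (n , 𝔄↔n) , ρ , ⊨φ) →
      VectorModel.vectors 𝔄 (layers φ) , (_ , Vec↔Fin^ 𝔄↔n _) , _ , vectors-⊨-reduce 𝔄 ρ ⊨φ)
    (λ (𝔅 , finite , β , ⊨reduce) → reduce⇒finSatisfiable β ⊨reduce finite)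

theorem3 : Σ (Fm → Fm) λ f →
    ((φ : Fm) → IsFO3NoEq (f φ))
    × Σ ℕ (λ c → Σ ℕ λ d → (φ : Fm) → size (f φ) ≤ c * size φ + d)
    × (ExcludedMiddle 0ℓ →
        ((φ : Fm) → (Satisfiable φ ⇔ Satisfiable (f φ)))
        × ((φ : Fm) → (FinSatisfiable φ ⇔ FinSatisfiable (f φ))))
theorem3 =
  reduce , reduce-FO3 , (253 , 150 , size-reduce) ,
  λ lem → reduce-satisfiable lem , reduce-finSatisfiable lem
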